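{- Let $\mathcal{S} = \langle S, +_S, \cdot_S, 0_S, 1_S \rangle$ be an arbitrary semiring, and let $\sim$ denote any equivalence relation on $\sigma$-LTSs that is finer than directed simulation equivalence and coarser than bisimilarity. There does not exist a class $\mathcal{C}$ of $\sigma$-LTSs such that, for all finite $\sigma$-LTSs $M_a$ and $N_b$, we have $\textrm{hom}_{\mathcal{S}}(\mathcal{C},M_a) = \textrm{hom}_{\mathcal{S}}(\mathcal{C},N_b)$ if and only if $M_a \sim N_b$.
   Context: A $\sigma$-LTS is a structure over a modal signature $\sigma$ (finitely many unary proposition letters, finitely many binary actions $R_i$, $i\in I$) with one distinguished element. A directed simulation from $M_a$ to $N_b$ is a relation $Z$ containing $(a,b)$ such that whenever $(m,n)\in Z$: every proposition letter true at $m$ is true at $n$; for each $R_i^M(m,s)$ there is $t$ with $R_i^N(n,t)$ and $(s,t)\in Z$; and for each $R_i^N(n,t)$ there is $s$ with $R_i^M(m,s)$ and $(s,t)\in Z$. $M_a$, $N_b$ are directed simulation equivalent if directed simulations exist in both directions; a bisimulation is such a $Z$ where moreover $m$ and $n$ satisfy exactly the same proposition letters, and $M_a$, $N_b$ are bisimilar if one exists. "$\sim$ is finer than $\approx$" means $M_a\sim N_b$ implies $M_a\approx N_b$; so here bisimilar LTSs are $\sim$-related and $\sim$-related LTSs are directed simulation equivalent. For a semiring $\mathcal{S}$, $\textrm{count}_\mathcal{S}(n)$ is $0_S$ if $n=0$ and the $n$-fold sum $1_S+_S\cdots+_S 1_S$ otherwise; $\textrm{hom}_{\mathcal{S}}(T_c,M_a)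 = \textrm{count}_\mathcal{S}(\text{number of homomorphisms from } T_c \text{ to } M_a \text{ mapping } c \text{ to } a)$, and $\textrm{hom}_{\mathcal{S}}(\mathcal{C},M_a)$ is the $\mathcal{C}$-indexed vector of these values. -}

module Defs where

open import Data.Nat using (ℕ; zero; suc)
open import Data.Fin using (Fin; _≟_)
open import Data.Bool using (Bool; true; false; _∧_; _∨_; not)
open import Data.List using (List; []; _∷_; map; concatMap; allFin)
open import Data.Product using (Σ; ∃; _×_; _,_)
open import Relation.Nullary.Decidable using (⌊_⌋)
open import Relation.Binary.PropositionalEquality using (_≡_)
open import Algebra.Bundles using (Semiring)
open import Level using (Level)

-- A finite σ-LTS over a modal signature σ with p proposition letters
-- (indexed by Fin p) and k actions R_i (indexed by Fin k), with a
-- distinguished element.  Domain = Fin size.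
record LTS (p k : ℕ) : Set where
  field
    size : ℕ
    pt   : Fin size
    val  : Fin p → Fin size → Bool
    rel  : Fin k → Fin size → Fin size → Bool
open LTS public

IsDirSim : ∀ {p k} (M N : LTS p k) → (Fin (size M) → Fin (size N) → Set) → Set
IsDirSim {p} {k} M N Z =
  Z (pt M) (pt N) ×
  (∀ m n → Z m n →
     (∀ (q : Fin p) → val M q m ≡ true → val N q n ≡ true) ×
     (∀ (i : Fin k) s → rel M i m s ≡ true → ∃ λ t → rel N i n t ≡ true × Z s t) ×
     (∀ (i : Fin k) t → rel N i n t ≡ true → ∃ λ s → rel M i m s ≡ true × Z s t))

DirSim : ∀ {p k} (M N : LTS p k) → Set₁
DirSim M N = Σ (Fin (size M) → Fin (size N) → Set) (IsDirSim M N)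

DirSimEquiv : ∀ {p k} (M N : LTS p k) → Set₁
DirSimEquiv M N = DirSim M N × DirSim N M

IsBisim : ∀ {p k} (M N : LTS p k) → (Fin (size M) → Fin (size N) → Set) → Set
IsBisim {p} {k} M N Z =
  Z (pt M) (pt N) ×
  (∀ m n → Z m n →
     (∀ (q : Fin p) → val M q m ≡ val N q n) ×
     (∀ (i : Fin k) s → rel M i m s ≡ true → ∃ λ t → rel N i n t ≡ true × Z s t) ×
     (∀ (i : Fin k) t → rel N i n t ≡ true → ∃ λ s → rel M i m s ≡ true × Z s t))

Bisimilar : ∀ {p k} (M N : LTS p k) → Set₁
Bisimilar M N = Σ (Fin (size M) → Fin (size N) → Set) (IsBisim M N)

allFuns : (m n : ℕ) → List (Fin m → Fin n)
allFuns zero    n = (λ ()) ∷ []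
allFuns (suc m) n =
  concatMap (λ f → map (λ x → λ { Fin.zero → x ; (Fin.suc j) → f j }) (allFin n))
            (allFuns m n)

allᵇ : ∀ {A : Set} → (A → Bool) → List A → Bool
allᵇ f []       = true
allᵇ f (x ∷ xs) = f x ∧ allᵇ f xs

countᵇ : ∀ {A : Set} → (A → Bool) → List A → ℕ
countᵇ f []       = zero
countᵇ f (x ∷ xs) with f x
... | true  = suc (countᵇ f xs)
... | false = countᵇ f xs

_⇒ᵇ_ : Bool → Bool → Bool
a ⇒ᵇ b = not a ∨ b

isHom : ∀ {p k} (T M : LTS p k) → (Fin (size T) → Fin (size M)) → Bool
isHom {p} {k} T M h =
  ⌊ h (pt T) ≟ pt M ⌋ ∧
  allᵇ (λ q → allᵇ (λ x → val T q x ⇒ᵇ val M q (h x)) (allFin (size T))) (allFin p) ∧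
  allᵇ (λ i → allᵇ (λ x → allᵇ (λ y → rel T i x y ⇒ᵇ rel M i (h x) (h y))
                             (allFin (size T))) (allFin (size T))) (allFin k)

homNum : ∀ {p k} (T M : LTS p k) → ℕ
homNum T M = countᵇ (isHom T M) (allFuns (size T) (size M))

module _ {c ℓ : Level} (S : Semiring c ℓ) where
  open Semiring S

  count : ℕ → Carrier
  count zero          = 0#
  count (suc zero)    = 1#
  count (suc (suc n)) = count (suc n) + 1#

  hom : ∀ {p k} (T M : LTS p k) → Carrier
  hom T M = count (homNum T M)

-- Let K m (complete m) be the complete LTS on m + 1 points, with every letter
-- true and every action total, and L (loopWithDeadEnd) the two-point LTS whose
-- root satisfies every letter and, for every action, has a loop and an edge to
-- a dead end.  Every K m is bisimilar to K 0, so every T in C with e + 1 points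
-- has count((m + 1)^e) = hom(T, K m) ≈ hom(T, K 0) = 1_S for all m.  When
-- e ≥ 1 this forces 1_S + 1_S ≈ 1_S, so every positive count is 1_S; as
-- hom(T, L) is positive (the constant map to the root), and at most 2^e, T does
-- not distinguish K 0 from L.  Hence K 0 ∼ L, yet the dead end of L rules out a
-- directed simulation from K 0 to L.
module Submission where

open import Defs
open import Level using (Level)
open import Data.Nat using (ℕ; zero; suc; pred; _+_; _*_; _^_; _≤_; s≤s; z≤n)
open import Data.Nat.Properties 
  using (+-identityʳ; *-identityʳ; *-zeroʳ; ^-zeroˡ; +-suc; +-assoc; *-suc; *-comm; n≤1+n; ≤-reflexive; ≤-trans; ≤-antisym; suc-pred; m^n≢0)
open import Data.Nat.ListAction using (sum)
open import Data.Fin using (Fin; _≟_) renaming (zero to fz; suc to fs)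
open import Data.Bool using (Bool; true; false; _∧_; not)
open import Data.Bool.Properties using (∨-zeroʳ; ∧-identityʳ)
open import Data.List using (List; []; _∷_; map; concatMap; allFin; _++_; length)
open import Data.List.Properties using (map-cong; map-tabulate; length-tabulate)
open import Data.List.Relation.Unary.Any as Any using (Any; here; there)
open import Data.List.Relation.Unary.Any.Properties using (map⁺; ++⁺ˡ; ++⁺ʳ)
open import Data.List.Membership.Propositional.Properties using (∈-allFin)
open import Data.Product using (Σ; ∃-syntax; _×_; _,_; proj₁; proj₂)
open import Data.Unit using (⊤; tt)
open import Relation.Nullary using (¬_)
open import Relation.Nullary.Decidable using (⌊_⌋; dec-true; isYes≗does)
open import Relation.Binary.Structures using (IsEquivalence)
open import Relation.Binary.PropositionalEquality using (_≡_; refl; sym; trans; cong; cong₂; module ≡-Reasoning)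
open import Algebra.Bundles using (Semiring)
import Relation.Binary.Reasoning.Setoid as SetoidReasoning

private
  variable
    A B : Set

countᵇ-++ : (f : A → Bool) (xs ys : List A) →
            countᵇ f (xs ++ ys) ≡ countᵇ f xs + countᵇ f ys
countᵇ-++ f []       ys = refl
countᵇ-++ f (x ∷ xs) ys with f x
... | true  = cong suc (countᵇ-++ f xs ys)
... | false = countᵇ-++ f xs ys

countᵇ-concatMap : (f : B → Bool) (g : A → List B) (xs : List A) →
                   countᵇ f (concatMap g xs) ≡ sum (map (λ x → countᵇ f (g x)) xs)
countᵇ-concatMap f g []       = refl
countᵇ-concatMap f g (x ∷ xs) =
  trans (countᵇ-++ f (g x) (concatMap g xs)) (cong (countᵇ f (g x) +_) (countᵇ-concatMap f g xs))

countᵇ-map : (f : B → Bool) (g : A → B) (xs : List A) →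
             countᵇ f (map g xs) ≡ countᵇ (λ x → f (g x)) xs
countᵇ-map f g []       = refl
countᵇ-map f g (x ∷ xs) with f (g x)
... | true  = cong suc (countᵇ-map f g xs)
... | false = countᵇ-map f g xs

countᵇ-mono : {f g : A → Bool} → (∀ x → f x ≡ true → g x ≡ true) →
              ∀ xs → countᵇ f xs ≤ countᵇ g xs
countᵇ-mono                 f⇒g []       = z≤n
countᵇ-mono {f = f} {g = g} f⇒g (x ∷ xs) with f x in fx | g x in gx
... | true  | true  = s≤s (countᵇ-mono f⇒g xs)
... | false | true  = ≤-trans (countᵇ-mono f⇒g xs) (n≤1+n _)
... | false | false = countᵇ-mono f⇒g xs
... | true  | false with () ← trans (sym gx) (f⇒g x fx)

countᵇ-cong : {f g : A → Bool} → (∀ x → f x ≡ g x) → ∀ xs → countᵇ f xs ≡ countᵇ g xs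
countᵇ-cong f≗g xs = ≤-antisym (countᵇ-mono (λ x fx → trans (sym (f≗g x)) fx) xs)
                               (countᵇ-mono (λ x gx → trans (f≗g x) gx) xs)

countᵇ-true : (xs : List A) → countᵇ (λ _ → true) xs ≡ length xs
countᵇ-true []       = refl
countᵇ-true (x ∷ xs) = cong suc (countᵇ-true xs)

countᵇ-false : (xs : List A) → countᵇ (λ _ → false) xs ≡ 0
countᵇ-false []       = refl
countᵇ-false (x ∷ xs) = countᵇ-false xs

countᵇ-positive : {f : A → Bool} {xs : List A} → Any (λ x → f x ≡ true) xs → 1 ≤ countᵇ f xs
countᵇ-positive {xs = x ∷ xs} (here fx) rewrite fx = s≤s z≤n
countᵇ-positive {f = f} {xs = x ∷ xs} (there any) with f x
... | true  = s≤s z≤n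
... | false = countᵇ-positive any

sum-countᵇ-constant : (P : A → Bool) (ys : List B) (xs : List A) →
                      sum (map (λ x → countᵇ (λ _ → P x) ys) xs) ≡ countᵇ P xs * length ys
sum-countᵇ-constant P ys []       = refl
sum-countᵇ-constant P ys (x ∷ xs) with P x
... | true  = cong₂ _+_ (countᵇ-true ys) (sum-countᵇ-constant P ys xs)
... | false = trans (cong (_+ sum (map (λ x → countᵇ (λ _ → P x) ys) xs)) (countᵇ-false ys))
                    (sum-countᵇ-constant P ys xs)

allᵇ-true : (f : A → Bool) (xs : List A) → (∀ x → f x ≡ true) → allᵇ f xs ≡ true
allᵇ-true f []       _  = refl
allᵇ-true f (x ∷ xs) fx rewrite fx x = allᵇ-true f xs fx

∧-trueˡ : ∀ x {y} → x ∧ y ≡ true → x ≡ true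
∧-trueˡ true _ = refl

⇒ᵇ-true : ∀ a {b} → b ≡ true → (a ⇒ᵇ b) ≡ true
⇒ᵇ-true a refl = ∨-zeroʳ (not a)

countᵇ-≟-allFin : ∀ {n} (j : Fin n) → countᵇ (λ x → ⌊ x ≟ j ⌋) (allFin n) ≡ 1
countᵇ-≟-allFin {suc n} j = begin
    countᵇ (λ x → ⌊ x ≟ j ⌋) (allFin (suc n))
  ≡⟨ cong (λ xs → countᵇ (λ x → ⌊ x ≟ j ⌋) (fz ∷ xs)) (sym (map-tabulate (λ x → x) fs)) ⟩
    countᵇ (λ x → ⌊ x ≟ j ⌋) (fz ∷ map fs (allFin n))
  ≡⟨ lemma j ⟩
    1 ∎
  where
  open ≡-Reasoning
  lemma : (j : Fin (suc n)) → countᵇ (λ x → ⌊ x ≟ j ⌋) (fz ∷ map fs (allFin n)) ≡ 1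
  lemma fz     = cong suc (trans (countᵇ-map (λ x → ⌊ x ≟ fz ⌋) fs (allFin n)) (countᵇ-false (allFin n)))
  lemma (fs i) = begin
      countᵇ (λ x → ⌊ x ≟ fs i ⌋) (map fs (allFin n))
    ≡⟨ countᵇ-map (λ x → ⌊ x ≟ fs i ⌋) fs (allFin n) ⟩
      countᵇ (λ x → ⌊ fs x ≟ fs i ⌋) (allFin n)
    ≡⟨ countᵇ-cong (λ x → trans (isYes≗does (fs x ≟ fs i)) (sym (isYes≗does (x ≟ i)))) (allFin n) ⟩
      countᵇ (λ x → ⌊ x ≟ i ⌋) (allFin n)
    ≡⟨ countᵇ-≟-allFin i ⟩
      1 ∎

length-allFuns : ∀ m n → length (allFuns m n) ≡ n ^ m
length-allFuns zero    n = refl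
length-allFuns (suc m) n = begin
    length (allFuns (suc m) n)
  ≡⟨ sym (countᵇ-true (allFuns (suc m) n)) ⟩
    countᵇ (λ _ → true) (allFuns (suc m) n)
  ≡⟨ countᵇ-concatMap _ _ (allFuns m n) ⟩
    sum (map (λ f → countᵇ (λ _ → true) (map _ (allFin n))) (allFuns m n))
  ≡⟨ cong sum (map-cong (λ f → countᵇ-map _ _ (allFin n)) (allFuns m n)) ⟩
    sum (map (λ f → countᵇ (λ _ → true) (allFin n)) (allFuns m n))
  ≡⟨ sum-countᵇ-constant (λ _ → true) (allFin n) (allFuns m n) ⟩
    countᵇ (λ _ → true) (allFuns m n) * length (allFin n)
  ≡⟨ cong₂ _*_ (trans (countᵇ-true (allFuns m n)) (length-allFuns m n)) (length-tabulate (λ x → x)) ⟩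
    n ^ m * n
  ≡⟨ *-comm (n ^ m) n ⟩
    n ^ suc m ∎
  where open ≡-Reasoning

-- allFuns (suc e) n lists the functions by their value at fz (inner loop)
-- and their restriction to the remaining points (outer loop).
countᵇ-allFuns-≟ : ∀ e n (c : Fin (suc e)) (j : Fin n) →
                   countᵇ (λ h → ⌊ h c ≟ j ⌋) (allFuns (suc e) n) ≡ n ^ e
countᵇ-allFuns-≟ e n fz j = begin
    countᵇ (λ h → ⌊ h fz ≟ j ⌋) (allFuns (suc e) n)
  ≡⟨ countᵇ-concatMap _ _ (allFuns e n) ⟩
    sum (map (λ f → countᵇ (λ h → ⌊ h fz ≟ j ⌋) (map _ (allFin n))) (allFuns e n))
  ≡⟨ cong sum (map-cong (λ f → trans (countᵇ-map _ _ (allFin n)) (countᵇ-≟-allFin j)) (allFuns e n)) ⟩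
    sum (map (λ _ → countᵇ (λ _ → true) (j ∷ [])) (allFuns e n))
  ≡⟨ sum-countᵇ-constant (λ _ → true) (j ∷ []) (allFuns e n) ⟩
    countᵇ (λ _ → true) (allFuns e n) * 1
  ≡⟨ trans (*-identityʳ _) (countᵇ-true (allFuns e n)) ⟩
    length (allFuns e n)
  ≡⟨ length-allFuns e n ⟩
    n ^ e ∎
  where open ≡-Reasoning
countᵇ-allFuns-≟ (suc e) n (fs c) j = begin
    countᵇ (λ h → ⌊ h (fs c) ≟ j ⌋) (allFuns (suc (suc e)) n)
  ≡⟨ countᵇ-concatMap _ _ (allFuns (suc e) n) ⟩
    sum (map (λ f → countᵇ (λ h → ⌊ h (fs c) ≟ j ⌋) (map _ (allFin n))) (allFuns (suc e) n))
  ≡⟨ cong sum (map-cong (λ f → countᵇ-map _ _ (allFin n)) (allFuns (suc e) n)) ⟩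
    sum (map (λ f → countᵇ (λ _ → ⌊ f c ≟ j ⌋) (allFin n)) (allFuns (suc e) n))
  ≡⟨ sum-countᵇ-constant (λ f → ⌊ f c ≟ j ⌋) (allFin n) (allFuns (suc e) n) ⟩
    countᵇ (λ f → ⌊ f c ≟ j ⌋) (allFuns (suc e) n) * length (allFin n)
  ≡⟨ cong₂ _*_ (countᵇ-allFuns-≟ e n c j) (length-tabulate (λ x → x)) ⟩
    n ^ e * n
  ≡⟨ *-comm (n ^ e) n ⟩
    n ^ suc e ∎
  where open ≡-Reasoning

allFuns-complete : ∀ m n (g : Fin m → Fin n) → Any (λ h → ∀ x → h x ≡ g x) (allFuns m n)
allFuns-complete zero    n g = here (λ ())
allFuns-complete (suc m) n g = anyConcatMap (allFuns m n)
  (Any.map (λ {f} f≗g → map⁺ (Any.map (λ { refl → λ { fz → refl ; (fs x) → f≗g x } })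
                                      (∈-allFin (g fz))))
           (allFuns-complete m n (λ x → g (fs x))))
  where
  anyConcatMap : ∀ {P : (Fin (suc m) → Fin n) → Set} {G : (Fin m → Fin n) → List (Fin (suc m) → Fin n)} xs →
                 Any (λ f → Any P (G f)) xs → Any P (concatMap G xs)
  anyConcatMap (f ∷ _)              (here p)  = ++⁺ˡ p
  anyConcatMap {G = G} (f ∷ rest) (there q) = ++⁺ʳ (G f) (anyConcatMap rest q)

suc^-positive : ∀ m e → ∃[ r ] suc m ^ e ≡ suc r
suc^-positive m e = pred (suc m ^ e) , sym (suc-pred (suc m ^ e) {{m^n≢0 (suc m) e}})

2^suc≡2+ : ∀ e → ∃[ q ] 2 ^ suc e ≡ 2 + q
2^suc≡2+ e with r , 2^e≡1+r ← suc^-positive 1 e = r + r , (begin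
    2 * 2 ^ e          ≡⟨ cong (2 *_) 2^e≡1+r ⟩
    suc r + (suc r + 0) ≡⟨ cong (λ s → suc (r + suc s)) (+-identityʳ r) ⟩
    suc (r + suc r)    ≡⟨ cong suc (+-suc r r) ⟩
    2 + (r + r)        ∎)
  where open ≡-Reasoning

module _ {c ℓ : Level} (S : Semiring c ℓ) where
  open Semiring S
    using (_≈_; 1#)
    renaming (_+_ to _⊕_; +-congˡ to ⊕-congˡ; +-congʳ to ⊕-congʳ; +-assoc to ⊕-assoc; +-comm to ⊕-comm; +-identityˡ to ⊕-identityˡ; refl to ≈-refl; sym to ≈-sym; trans to ≈-trans; reflexive to ≈-reflexive)
  open SetoidReasoning (Semiring.setoid S)

  count-suc : ∀ n → count S (suc n) ≈ count S n ⊕ 1#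
  count-suc zero    = ≈-sym (⊕-identityˡ 1#)
  count-suc (suc n) = ≈-refl

  count-+ : ∀ m n → count S (m + n) ≈ count S m ⊕ count S n
  count-+ zero    n = ≈-sym (⊕-identityˡ (count S n))
  count-+ (suc m) n = begin
      count S (suc (m + n))            ≈⟨ count-suc (m + n) ⟩
      count S (m + n) ⊕ 1#             ≈⟨ ⊕-congʳ (count-+ m n) ⟩
      (count S m ⊕ count S n) ⊕ 1#     ≈⟨ ⊕-assoc _ _ _ ⟩
      count S m ⊕ (count S n ⊕ 1#)     ≈⟨ ⊕-congˡ (⊕-comm _ _) ⟩
      count S m ⊕ (1# ⊕ count S n)     ≈⟨ ⊕-assoc _ _ _ ⟨
      (count S m ⊕ 1#) ⊕ count S n     ≈⟨ ⊕-congʳ (count-suc m) ⟨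
      count S (suc m) ⊕ count S n      ∎

  count-periodic : ∀ d → count S (suc d) ≈ 1# → ∀ j n → count S (suc n + d * j) ≈ count S (suc n)
  count-periodic d period zero    n =
    ≈-reflexive (cong (λ m → count S (suc m)) (trans (cong (n +_) (*-zeroʳ d)) (+-identityʳ n)))
  count-periodic d period (suc j) n = begin
      count S (suc n + d * suc j)        ≡⟨ cong (λ m → count S (suc n + m)) (*-suc d j) ⟩
      count S (suc n + (d + d * j))      ≡⟨ cong (count S) (+-assoc (suc n) d (d * j)) ⟨
      count S (suc (n + d) + d * j)      ≈⟨ count-periodic d period j (n + d) ⟩
      count S (suc n + d)                ≡⟨ cong (count S) (sym (+-suc n d)) ⟩
      count S (n + suc d)                ≈⟨ count-+ n (suc d) ⟩
      count S n ⊕ count S (suc d)        ≈⟨ ⊕-congˡ period ⟩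
      count S n ⊕ 1#                     ≈⟨ count-suc n ⟨
      count S (suc n)                    ∎

  count-collapse : count S 2 ≈ 1# → ∀ n → count S (suc n) ≈ 1#
  count-collapse 1+1≈1 zero    = ≈-refl
  count-collapse 1+1≈1 (suc n) = ≈-trans (⊕-congʳ (count-collapse 1+1≈1 n)) 1+1≈1

  count-powers-collapse : ∀ e → (∀ m → count S (suc m ^ suc e) ≈ 1#) → ∀ n → count S (suc n) ≈ 1#
  count-powers-collapse e powers≈1 with q , 2^[1+e]≡2+q ← 2^suc≡2+ e = count-collapse 1+1≈1
    where
    -- With d = 2^(e+1) - 1 = q + 1, count has period d, and d^(e+1) is a
    -- positive multiple of d, so count d ≈ 1 as well as count (d + 1) ≈ 1.
    d+1≈1 : count S (2 + q) ≈ 1#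
    d+1≈1 = ≈-trans (≈-reflexive (cong (count S) (sym 2^[1+e]≡2+q))) (powers≈1 1)
    d≈1 : count S (suc q) ≈ 1#
    d≈1 with j , d^e≡1+j ← suc^-positive q e = begin
        count S (suc q)                 ≈⟨ count-periodic (suc q) d+1≈1 j q ⟨
        count S (suc q + suc q * j)     ≡⟨ cong (count S) (trans (cong (suc q *_) d^e≡1+j) (*-suc (suc q) j)) ⟨
        count S (suc q ^ suc e)         ≈⟨ powers≈1 q ⟩
        1#                              ∎
    1+1≈1 : count S 2 ≈ 1#
    1+1≈1 = begin
        1# ⊕ 1#              ≈⟨ ⊕-congʳ d≈1 ⟨
        count S (suc q) ⊕ 1# ≈⟨ count-suc (suc q) ⟨
        count S (2 + q)      ≈⟨ d+1≈1 ⟩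
        1#                   ∎

module _ {p k : ℕ} where

  complete : ℕ → LTS p k
  complete m = record { size = suc m ; pt = fz ; val = λ _ _ → true ; rel = λ _ _ _ → true }

  loopWithDeadEnd : LTS p k
  loopWithDeadEnd = record
    { size = 2 ; pt = fz ; val = λ _ _ → true
    ; rel  = λ { _ fz _ → true ; _ (fs _) _ → false } }

  homNum-≤ : (T M : LTS p k) → homNum T M ≤ size M ^ pred (size T)
  homNum-≤ T@record { size = suc e } M = ≤-trans
    (countᵇ-mono (λ h → ∧-trueˡ ⌊ h (pt T) ≟ pt M ⌋) (allFuns (suc e) (size M)))
    (≤-reflexive (countᵇ-allFuns-≟ e (size M) (pt T) (pt M)))

  isHom-complete : ∀ (T : LTS p k) m h → isHom T (complete m) h ≡ ⌊ h (pt T) ≟ fz ⌋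
  isHom-complete T m h = trans
    (cong₂ (λ a b → ⌊ h (pt T) ≟ fz ⌋ ∧ a ∧ b)
      (allᵇ-true _ (allFin p) λ q → allᵇ-true _ (allFin (size T)) λ x → ⇒ᵇ-true (val T q x) refl)
      (allᵇ-true _ (allFin k) λ i → allᵇ-true _ (allFin (size T)) λ x →
         allᵇ-true _ (allFin (size T)) λ y → ⇒ᵇ-true (rel T i x y) refl))
    (∧-identityʳ _)

  homNum-complete : ∀ (T : LTS p k) m → homNum T (complete m) ≡ suc m ^ pred (size T)
  homNum-complete T@record { size = suc e } m =
    trans (countᵇ-cong (isHom-complete T m) (allFuns (suc e) (suc m))) (countᵇ-allFuns-≟ e (suc m) (pt T) fz)

  isHom-constant-root : ∀ (T M : LTS p k) h →
    (∀ q → val M q (pt M) ≡ true) → (∀ i → rel M i (pt M) (pt M) ≡ true) →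
    (∀ x → h x ≡ pt M) → isHom T M h ≡ true
  isHom-constant-root T M h root-letters root-loops h≡root = cong₂ _∧_
    (trans (isYes≗does (h (pt T) ≟ pt M)) (dec-true (h (pt T) ≟ pt M) (h≡root (pt T))))
    (cong₂ _∧_
      (allᵇ-true _ (allFin p) λ q → allᵇ-true _ (allFin (size T)) λ x →
         ⇒ᵇ-true (val T q x) (trans (cong (val M q) (h≡root x)) (root-letters q)))
      (allᵇ-true _ (allFin k) λ i → allᵇ-true _ (allFin (size T)) λ x →
         allᵇ-true _ (allFin (size T)) λ y →
           ⇒ᵇ-true (rel T i x y) (trans (cong₂ (rel M i) (h≡root x) (h≡root y)) (root-loops i))))

  homNum-loopWithDeadEnd-positive : (T : LTS p k) → 1 ≤ homNum T loopWithDeadEnd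
  homNum-loopWithDeadEnd-positive T = countᵇ-positive
    (Any.map (λ {h} h≡root → isHom-constant-root T loopWithDeadEnd h (λ _ → refl) (λ _ → refl) h≡root)
             (allFuns-complete (size T) 2 (λ _ → fz)))

  complete-bisimilar : ∀ m → Bisimilar (complete m) (complete 0)
  complete-bisimilar m =
    (λ _ _ → ⊤) , tt ,
    λ _ _ _ → (λ _ → refl) , (λ _ _ _ → fz , refl , tt) , (λ _ _ _ → fz , refl , tt)

  -- The root of L has an i-successor (the dead end) whose only possible
  -- partner in K 0 still has an i-successor.
  ¬DirSim-complete-loopWithDeadEnd : Fin k → ¬ DirSim (complete 0) loopWithDeadEnd
  ¬DirSim-complete-loopWithDeadEnd i (Z , Z-root , Z-sim)
    with fz , _ , Z-deadEnd ← proj₂ (proj₂ (Z-sim fz fz Z-root)) i (fs fz) refl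
    with _ , () , _ ← proj₁ (proj₂ (Z-sim fz (fs fz) Z-deadEnd)) i fz refl

hom-complete-constant⇒hom-loopWithDeadEnd :
  ∀ {c ℓ p k} (S : Semiring c ℓ) (T : LTS p k) →
  (∀ m → Semiring._≈_ S (hom S T (complete m)) (hom S T (complete 0))) →
  Semiring._≈_ S (hom S T (complete 0)) (hom S T loopWithDeadEnd)
hom-complete-constant⇒hom-loopWithDeadEnd S T@record { size = suc zero } _ =
  Semiring.reflexive S (cong (count S) (trans (homNum-complete T 0)
    (≤-antisym (homNum-loopWithDeadEnd-positive T) (homNum-≤ T loopWithDeadEnd))))
hom-complete-constant⇒hom-loopWithDeadEnd S T@record { size = suc (suc e) } hom-constant
  with homNum T loopWithDeadEnd | homNum-loopWithDeadEnd-positive T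
... | suc n | _ = begin
    hom S T (complete 0)  ≈⟨ hom-K₀≈1 ⟩
    1#                    ≈⟨ count-powers-collapse S e powers≈1 n ⟨
    count S (suc n)       ∎
  where
  open Semiring S using (_≈_; 1#) renaming (reflexive to ≈-reflexive; trans to ≈-trans)
  open SetoidReasoning (Semiring.setoid S)
  hom-K₀≈1 : hom S T (complete 0) ≈ 1#
  hom-K₀≈1 = ≈-reflexive (cong (count S) (trans (homNum-complete T 0) (^-zeroˡ (suc e))))
  powers≈1 : ∀ m → count S (suc m ^ suc e) ≈ 1#
  powers≈1 m = ≈-trans (≈-reflexive (cong (count S) (sym (homNum-complete T m))))
                       (≈-trans (hom-constant m) hom-K₀≈1)

theorem6p5 : ∀ {c ℓ ℓ₁ ℓ₂ : Level} (p k : ℕ) → 1 ≤ k →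
    (S : Semiring c ℓ) →
    (_∼_ : LTS p k → LTS p k → Set ℓ₁) → IsEquivalence _∼_ →
    (∀ M N → Bisimilar M N → M ∼ N) →
    (∀ M N → M ∼ N → DirSimEquiv M N) →
    ¬ (Σ (LTS p k → Set ℓ₂) λ C →
        ∀ M N →
          ((∀ T → C T → Semiring._≈_ S (hom S T M) (hom S T N)) → M ∼ N) ×
          (M ∼ N → ∀ T → C T → Semiring._≈_ S (hom S T M) (hom S T N)))
theorem6p5 p (suc k) _ S _∼_ _ bisimilar⇒∼ ∼⇒dirSimEquiv (C , C-characterises) =
  ¬DirSim-complete-loopWithDeadEnd fz (proj₁ (∼⇒dirSimEquiv _ _ K₀∼L))
  where
  K₀∼L : complete 0 ∼ loopWithDeadEnd
  K₀∼L = proj₁ (C-characterises (complete 0) loopWithDeadEnd) λ T T∈C →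
    hom-complete-constant⇒hom-loopWithDeadEnd S T λ m →
      proj₂ (C-characterises (complete m) (complete 0)) (bisimilar⇒∼ _ _ (complete-bisimilar m)) T T∈C
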